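{- Let $\mathbb{K}$ be a field of characteristic $0$, let $(\vartheta,\omega)\in\mathrm{BP}_n$, $\Lambda=\vartheta\uplus\omega$, $m$ the length of $\Lambda$, and let $z=(\underbrace{a_1,\dots,a_1}_{\Lambda_1},\underbrace{a_2,\dots,a_2}_{\Lambda_2},\dots,\underbrace{a_m,\dots,a_m}_{\Lambda_m})\in\mathbb{K}^n$ where $a_i^2\neq a_j^2$ for $i\neq j$ and $a_i\neq0$ for $i\le\mathrm{len}(\omega)$. Then (i) $z\notin V_{(\vartheta,\omega)}$; (ii) if $(\lambda,\mu)\in\mathrm{BP}_n$ satisfies $z\notin V_{(\lambda,\mu)}$, then $\Lambda\unlhd\lambda\uplus\mu$ in the dominance order on partitions.
   Context: A partition is a non-increasing sequence of non-negative integers (zero beyond its length $\mathrm{len}$); $\mathrm{BP}_n$ is the set of pairs of partitions of total size $n$; $\vartheta\uplus\omega=(\vartheta_1+\omega_1,\vartheta_2+\omega_2,\dots)$. Dominance: $\alpha\unlhd\beta$ iff $\sum_{j\le k}\alpha_j\le\sum_{j\le k}\beta_j$ for all $k$. A bitableau of shape $(\lambda,\mu)$ fills the pair of Young diagrams with $1,\dots,n$ each once; with $\Delta_{(i_1,\dots,i_r)}(\mathbf{y})=\prod_{j<k}(y_{i_j}-y_{i_k})$, its Specht polynomial is $\mathrm{sp}_{(T,S)}(\mathbf{x})=\prod_i\Delta_{T_i}(\mathbf{x}^2)\prod_j\Delta_{S_j}(\mathbf{x}^2)\prod_{k\in S}x_k$ ($T_i,S_j$ columns, $\mathbf{x}^2=(x_1^2,\dots,x_n^2)$).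 $V_{(\lambda,\mu)}\subset\mathbb{K}^n$ is the common zero set of all Specht polynomials of bitableaux of shape $(\lambda,\mu)$. -}

module Defs where

open import Level using (Level)
open import Data.Nat using (ℕ; zero; suc; _+_; _≤_; _<_; _≥_)
open import Data.Fin using (Fin; toℕ)
import Data.Fin as Fin
open import Data.Nat.ListAction using (sum)
open import Data.List using (List; []; _∷_; take; length; map; concat; replicate; upTo; _++_; allFin)
open import Data.List.Relation.Binary.Permutation.Propositional using (_↭_)
open import Data.Maybe using (Maybe; just; nothing)
open import Data.Product using (Σ; _×_; _,_; ∃)
open import Relation.Binary.PropositionalEquality using (_≡_)
open import Relation.Nullary using (¬_)
open import Algebra.Bundles using (CommutativeRing)
import Algebra.Definitions.RawMonoid as RM

-- Partitions: a partition is represented by its list of nonzero parts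
-- (λ₁ ≥ λ₂ ≥ … ≥ λ_len > 0); parts beyond the length are 0.

data NonIncreasing : List ℕ → Set where
  ni[]  : NonIncreasing []
  ni[-] : ∀ {x} → NonIncreasing (x ∷ [])
  ni∷   : ∀ {x y xs} → y ≤ x → NonIncreasing (y ∷ xs) → NonIncreasing (x ∷ y ∷ xs)

data AllPositive : List ℕ → Set where
  ap[] : AllPositive []
  ap∷  : ∀ {x xs} → 0 < x → AllPositive xs → AllPositive (x ∷ xs)

IsPartition : List ℕ → Set
IsPartition p = NonIncreasing p × AllPositive p

IsBP : ℕ → List ℕ → List ℕ → Set
IsBP n λ′ μ = IsPartition λ′ × IsPartition μ × sum λ′ + sum μ ≡ n

_⊎ₚ_ : List ℕ → List ℕ → List ℕ
[] ⊎ₚ ys = ys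
(x ∷ xs) ⊎ₚ [] = x ∷ xs
(x ∷ xs) ⊎ₚ (y ∷ ys) = (x + y) ∷ (xs ⊎ₚ ys)

_⊴_ : List ℕ → List ℕ → Set
α ⊴ β = ∀ k → sum (take k α) ≤ sum (take k β)

-- Tableaux. A (filled) Young diagram with entries in A is the list of
-- its rows (top to bottom), each row listed left to right.

HasShape : ∀ {a} {A : Set a} → List (List A) → List ℕ → Set
HasShape T p = map length T ≡ p

nth : ∀ {a} {A : Set a} → List A → ℕ → Maybe A
nth []       _       = nothing
nth (x ∷ xs) zero    = just x
nth (x ∷ xs) (suc j) = nth xs j

column : ∀ {a} {A : Set a} → List (List A) → ℕ → List A
column []       j = []
column (r ∷ rs) j with nth r j
... | just x  = x ∷ column rs j
... | nothing = column rs j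

columns : ∀ {a} {A : Set a} → ℕ → List (List A) → List (List A)
columns k T = map (column T) (upTo k)

-- A bitableau of shape (λ,μ) filled with 1,…,n (encoded as Fin n = {0,…,n-1}),
-- each used exactly once.
record Bitableau (n : ℕ) (λ′ μ : List ℕ) : Set where
  field
    T      : List (List (Fin n))
    S      : List (List (Fin n))
    shapeT : HasShape T λ′
    shapeS : HasShape S μ
    bij    : concat T ++ concat S ↭ allFin n

record IsField {c ℓ} (R : CommutativeRing c ℓ) : Set (c Level.⊔ ℓ) where
  open CommutativeRing R
  field
    0≉1     : ¬ (0# ≈ 1#)
    inverse : ∀ x → ¬ (x ≈ 0#) → ∃ λ y → x * y ≈ 1#

CharZero : ∀ {c ℓ} (R : CommutativeRing c ℓ) → Set ℓ
CharZero R = ∀ k → ¬ ((suc k ·1 1#) ≈ 0#)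
  where open CommutativeRing R
        open RM +-rawMonoid renaming (_×_ to _·1_)

module Specht {c ℓ} (R : CommutativeRing c ℓ) where
  open CommutativeRing R

  prod : List Carrier → Carrier
  prod []       = 1#
  prod (x ∷ xs) = x * prod xs

  Δ : ∀ {n} → (Fin n → Carrier) → List (Fin n) → Carrier
  Δ y []       = 1#
  Δ y (i ∷ is) = prod (map (λ k → y i - y k) is) * Δ y is

  sq : ∀ {n} → (Fin n → Carrier) → Fin n → Carrier
  sq x i = x i * x i

  -- sp_{(T,S)}(x) = ∏_i Δ_{T_i}(x²) ∏_j Δ_{S_j}(x²) ∏_{k ∈ S} x_k
  -- (every column index is < n, since the first row has length ≤ n)
  sp : ∀ {n λ′ μ} → Bitableau n λ′ μ → (Fin n → Carrier) → Carrier
  sp {n} B x =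
    prod (map (Δ (sq x)) (columns n (Bitableau.T B))) *
    prod (map (Δ (sq x)) (columns n (Bitableau.S B))) *
    prod (map x (concat (Bitableau.S B)))

  _∈V_ : ∀ {n} → (Fin n → Carrier) → List ℕ × List ℕ → Set ℓ
  _∈V_ {n} z (λ′ , μ) = ∀ (B : Bitableau n λ′ μ) → sp B z ≈ 0#

  blocks : (Λ : List ℕ) → (Fin (length Λ) → Carrier) → List Carrier
  blocks []      a = []
  blocks (l ∷ Λ) a = replicate l (a Fin.zero) ++ blocks Λ (λ i → a (Fin.suc i))

-- Colour position p of z by the index of the block containing it. Since the aᵢ² are
-- distinct, z_p² − z_q² vanishes exactly when p and q share a colour, so a Specht
-- polynomial is nonzero at z only if every column of its bitableau is rainbow (has
-- pairwise distinct colours).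
-- (i) Filling row i of both tableaux with cells of colour i gives a bitableau of shape
-- (ϑ, ω) with rainbow columns, and z does not vanish on S since its colours are < len ω.
-- (ii) If the columns of a bitableau of shape (λ, μ) are rainbow, a column of length λ′ⱼ
-- contains at most min(k, λ′ⱼ) cells of colour < k; summing over the columns gives
-- Λ₁ + … + Λₖ ≤ (λ₁ + … + λₖ) + (μ₁ + … + μₖ).

module Submission where

open import Defs
open import Level using (Level)
open import Function using (_∘_; id; const)
open import Algebra.Bundles using (CommutativeRing)
import Algebra.Properties.Ring as RingProperties
open import Data.Empty using (⊥-elim)
open import Data.Fin using (Fin; toℕ)
import Data.Fin as Fin
open import Data.Fin.Properties using (toℕ-injective)
open import Data.List using (List; []; _∷_; take; length; map; concat; replicate; _++_; tabulate; allFin)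
open import Data.List.Properties
  using (map-++; map-∘; length-map; map-cong-local; map-replicate; map-tabulate; ∷-injective; ++-assoc; ++-identityʳ)
open import Data.List.Relation.Binary.Permutation.Propositional
  using (_↭_; ↭-refl; ↭-sym; ↭-reflexive; module PermutationReasoning)
import Data.List.Relation.Binary.Permutation.Propositional.Properties as PermP
open import Data.List.Relation.Unary.All using (All; []; _∷_)
import Data.List.Relation.Unary.All as All
import Data.List.Relation.Unary.All.Properties as AllP
open import Data.List.Relation.Unary.AllPairs using (AllPairs; []; _∷_)
open import Data.Maybe using (just; nothing; maybe′)
import Data.Maybe.Relation.Unary.All as Maybe
open import Data.Nat using (ℕ; zero; suc; _+_; _⊓_; _≤_; _<_; z≤n; s≤s; _≟_; _≤?_)
open import Data.Nat.Properties
  using (≤-refl; ≤-trans; ≤-reflexive; <⇒≤; <⇒≢; ≰⇒>; n<1+n; +-suc; +-identityʳ; +-mono-≤; +-monoʳ-≤;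
         m≤m+n; m≤n+m; m<m+n; ⊓-glb; +-commutativeSemigroup; module ≤-Reasoning)
open import Algebra.Properties.CommutativeSemigroup +-commutativeSemigroup using (interchange)
open import Data.Nat.ListAction using (sum)
open import Data.Nat.ListAction.Properties using (sum-++; sum-↭)
open import Data.Product using (Σ; ∃₂; _×_; _,_; proj₁; proj₂; uncurry)
open import Data.Sum using (_⊎_; inj₁; inj₂)
import Data.Sum as Sum
open import Data.Vec.Functional using (toList)
open import Relation.Binary.PropositionalEquality
  using (_≡_; _≢_; refl; sym; trans; cong; cong₂; subst; subst₂; ≢-sym; module ≡-Reasoning)
import Relation.Binary.Reasoning.Setoid as ≈-Reasoning
open import Relation.Nullary using (¬_; yes; no)

variable
  A : Set
  f h : A → ℕ

∑ : List A → (A → ℕ) → ℕ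
∑ xs f = sum (map f xs)

syntax ∑ xs (λ x → e) = ∑[ x ∈ xs ] e

∑< : ℕ → (ℕ → ℕ) → ℕ
∑< zero    f = 0
∑< (suc m) f = f 0 + ∑< m (f ∘ suc)

syntax ∑< m (λ j → e) = ∑[ j < m ] e

∑-zero : ∀ (xs : List A) → ∑[ x ∈ xs ] 0 ≡ 0
∑-zero []       = refl
∑-zero (x ∷ xs) = ∑-zero xs

∑-++ : ∀ (xs ys : List A) → ∑[ x ∈ xs ++ ys ] f x ≡ ∑[ x ∈ xs ] f x + ∑[ x ∈ ys ] f x
∑-++ {f = f} xs ys = trans (cong sum (map-++ f xs ys)) (sum-++ (map f xs) (map f ys))

∑-map : ∀ {B : Set} {f : B → ℕ} (g : A → B) (xs : List A) → ∑[ y ∈ map g xs ] f y ≡ ∑[ x ∈ xs ] f (g x)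
∑-map g xs = cong sum (sym (map-∘ xs))

∑-mono : (∀ x → f x ≤ h x) → ∀ (xs : List A) → ∑[ x ∈ xs ] f x ≤ ∑[ x ∈ xs ] h x
∑-mono f≤h []       = z≤n
∑-mono f≤h (x ∷ xs) = +-mono-≤ (f≤h x) (∑-mono f≤h xs)

∑<-zero : ∀ m → ∑[ j < m ] 0 ≡ 0
∑<-zero zero    = refl
∑<-zero (suc m) = ∑<-zero m

∑<-cong : ∀ m → (∀ j → f j ≡ h j) → ∑[ j < m ] f j ≡ ∑[ j < m ] h j
∑<-cong zero    f≡h = refl
∑<-cong (suc m) f≡h = cong₂ _+_ (f≡h 0) (∑<-cong m (f≡h ∘ suc))

∑<-+ : ∀ m → ∑[ j < m ] (f j + h j) ≡ ∑[ j < m ] f j + ∑[ j < m ] h j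
∑<-+ zero = refl
∑<-+ {f = f} {h = h} (suc m) =
  trans (cong (f 0 + h 0 +_) (∑<-+ {f = f ∘ suc} {h = h ∘ suc} m)) (interchange (f 0) (h 0) _ _)

∑<-mono : ∀ m → (∀ j → j < m → f j ≤ h j) → ∑[ j < m ] f j ≤ ∑[ j < m ] h j
∑<-mono zero    f≤h = z≤n
∑<-mono (suc m) f≤h = +-mono-≤ (f≤h 0 (s≤s z≤n)) (∑<-mono m (λ j j<m → f≤h (suc j) (s≤s j<m)))

infix 4 ⟦_<_⟧

⟦_<_⟧ : ℕ → ℕ → ℕ
⟦ _     < zero  ⟧ = 0
⟦ zero  < suc _ ⟧ = 1
⟦ suc j < suc x ⟧ = ⟦ j < x ⟧

⟦<⟧≤1 : ∀ j x → ⟦ j < x ⟧ ≤ 1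
⟦<⟧≤1 j       zero    = z≤n
⟦<⟧≤1 zero    (suc x) = ≤-refl
⟦<⟧≤1 (suc j) (suc x) = ⟦<⟧≤1 j x

⟦<⟧≡0 : ∀ {j x} → x ≤ j → ⟦ j < x ⟧ ≡ 0
⟦<⟧≡0 {x = zero} _  = refl
⟦<⟧≡0 (s≤s x≤j) = ⟦<⟧≡0 x≤j

⟦<⟧≡1 : ∀ {j x} → j < x → ⟦ j < x ⟧ ≡ 1
⟦<⟧≡1 {zero}  (s≤s _)   = refl
⟦<⟧≡1 {suc j} (s≤s j<x) = ⟦<⟧≡1 j<x

⟦<1+⟧≡⟦<⟧ : ∀ {x k} → x ≢ k → ⟦ x < suc k ⟧ ≡ ⟦ x < k ⟧
⟦<1+⟧≡⟦<⟧ {zero}  {zero}  x≢k = ⊥-elim (x≢k refl)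
⟦<1+⟧≡⟦<⟧ {zero}  {suc k} x≢k = refl
⟦<1+⟧≡⟦<⟧ {suc x} {zero}  x≢k = refl
⟦<1+⟧≡⟦<⟧ {suc x} {suc k} x≢k = ⟦<1+⟧≡⟦<⟧ (x≢k ∘ cong suc)

Rainbow : (A → ℕ) → List A → Set
Rainbow g = AllPairs (λ p q → g p ≢ g q)

module _ (g : A → ℕ) where

  count-<-suc : ∀ {k} {xs : List A} → Rainbow g xs →
                ∑[ p ∈ xs ] ⟦ g p < suc k ⟧ ≤ suc (∑[ p ∈ xs ] ⟦ g p < k ⟧)
  count-<-suc [] = z≤n
  count-<-suc {k} {p ∷ xs} (p≢xs ∷ rainbow) with g p ≟ k
  ... | no gp≢k rewrite ⟦<1+⟧≡⟦<⟧ gp≢k =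
    ≤-trans (+-monoʳ-≤ ⟦ g p < k ⟧ (count-<-suc rainbow)) (≤-reflexive (+-suc _ _))
  ... | yes refl rewrite ⟦<⟧≡1 (n<1+n (g p)) | ⟦<⟧≡0 (≤-refl {g p}) =
    s≤s (≤-reflexive (cong sum (map-cong-local (All.map (⟦<1+⟧≡⟦<⟧ ∘ ≢-sym) p≢xs))))

  count-< : ∀ k {xs : List A} → Rainbow g xs → ∑[ p ∈ xs ] ⟦ g p < k ⟧ ≤ k
  count-< zero    {xs} _  = ≤-reflexive (∑-zero xs)
  count-< (suc k) rainbow = ≤-trans (count-<-suc rainbow) (s≤s (count-< k rainbow))

-- Conjugate partitions

conjugate : List ℕ → ℕ → ℕ
conjugate ps j = ∑[ x ∈ ps ] ⟦ j < x ⟧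

∑<-⟦<⟧ : ∀ {m x} → x ≤ m → ∑[ j < m ] ⟦ j < x ⟧ ≡ x
∑<-⟦<⟧ {m} {zero} _ = ∑<-zero m
∑<-⟦<⟧ (s≤s x≤m)    = cong suc (∑<-⟦<⟧ x≤m)

∑<-conjugate : ∀ {m} ps → All (_≤ m) ps → ∑[ j < m ] conjugate ps j ≡ sum ps
∑<-conjugate {m} []       []           = ∑<-zero m
∑<-conjugate {m} (x ∷ ps) (x≤m ∷ ps≤m) =
  trans (∑<-+ m) (cong₂ _+_ (∑<-⟦<⟧ x≤m) (∑<-conjugate ps ps≤m))

NonIncreasing-tail : ∀ {x xs} → NonIncreasing (x ∷ xs) → NonIncreasing xs
NonIncreasing-tail ni[-]      = ni[]
NonIncreasing-tail (ni∷ _ ni) = ni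

conjugate≡0 : ∀ {x ps j} → NonIncreasing (x ∷ ps) → x ≤ j → conjugate (x ∷ ps) j ≡ 0
conjugate≡0 ni[-]        x≤j = cong (_+ 0) (⟦<⟧≡0 x≤j)
conjugate≡0 (ni∷ y≤x ni) x≤j = cong₂ _+_ (⟦<⟧≡0 x≤j) (conjugate≡0 ni (≤-trans y≤x x≤j))

⊓-conjugate≤conjugate-take : ∀ k {ps} → NonIncreasing ps → ∀ j →
                             k ⊓ conjugate ps j ≤ conjugate (take k ps) j
⊓-conjugate≤conjugate-take zero    _    j = z≤n
⊓-conjugate≤conjugate-take (suc k) {[]} _ j = z≤n
⊓-conjugate≤conjugate-take (suc k) {x ∷ ps} ni j with x ≤? j
... | yes x≤j = subst (λ c → suc k ⊓ c ≤ conjugate (x ∷ take k ps) j) (sym (conjugate≡0 ni x≤j)) z≤n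
... | no x≰j rewrite ⟦<⟧≡1 (≰⇒> x≰j) =
  s≤s (⊓-conjugate≤conjugate-take k (NonIncreasing-tail ni) j)

All-≤-sum : ∀ xs → All (_≤ sum xs) xs
All-≤-sum []       = []
All-≤-sum (x ∷ xs) = m≤m+n x (sum xs) ∷ All.map (λ y≤ → ≤-trans y≤ (m≤n+m (sum xs) x)) (All-≤-sum xs)

sum-take-⊎ₚ : ∀ k xs ys → sum (take k (xs ⊎ₚ ys)) ≡ sum (take k xs) + sum (take k ys)
sum-take-⊎ₚ zero    xs       ys       = refl
sum-take-⊎ₚ (suc k) []       ys       = refl
sum-take-⊎ₚ (suc k) (x ∷ xs) []       = sym (+-identityʳ _)
sum-take-⊎ₚ (suc k) (x ∷ xs) (y ∷ ys) =
  trans (cong (x + y +_) (sum-take-⊎ₚ k xs ys)) (interchange x y _ _)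

IsBP⇒parts≤ : ∀ {n λ′ μ} → IsBP n λ′ μ → All (_≤ n) λ′ × All (_≤ n) μ
IsBP⇒parts≤ {λ′ = λ′} {μ} (_ , _ , refl) =
  All.map (λ x≤ → ≤-trans x≤ (m≤m+n (sum λ′) (sum μ))) (All-≤-sum λ′) ,
  All.map (λ x≤ → ≤-trans x≤ (m≤n+m (sum μ) (sum λ′))) (All-≤-sum μ)

columns⁺ : ∀ {p} {P : List A → Set p} {m T} → (∀ j → P (column T j)) → All P (columns m T)
columns⁺ {m = m} Pcol = AllP.map⁺ (AllP.applyUpTo⁺₂ id m Pcol)

columns⁻ : ∀ {p} {P : List A → Set p} {m T} → All P (columns m T) → ∀ {j} → j < m → P (column T j)
columns⁻ {m = m} Pcols = AllP.applyUpTo⁻ id m (AllP.map⁻ Pcols)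

∑-column-∷ : ∀ (r : List A) rs j →
             ∑[ p ∈ column (r ∷ rs) j ] f p ≡ maybe′ f 0 (nth r j) + ∑[ p ∈ column rs j ] f p
∑-column-∷ r rs j with nth r j
... | just _  = refl
... | nothing = refl

maybe-nth≡⟦<length⟧ : ∀ (r : List A) j → maybe′ (const 1) 0 (nth r j) ≡ ⟦ j < length r ⟧
maybe-nth≡⟦<length⟧ []      j       = refl
maybe-nth≡⟦<length⟧ (x ∷ r) zero    = refl
maybe-nth≡⟦<length⟧ (x ∷ r) (suc j) = maybe-nth≡⟦<length⟧ r j

size-column : ∀ (T : List (List A)) j → ∑[ p ∈ column T j ] 1 ≡ conjugate (map length T) j
size-column []       j = refl
size-column (r ∷ rs) j =
  trans (∑-column-∷ r rs j) (cong₂ _+_ (maybe-nth≡⟦<length⟧ r j) (size-column rs j))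

∑<-nth : ∀ {m} (r : List A) → length r ≤ m → ∑[ j < m ] maybe′ f 0 (nth r j) ≡ ∑[ p ∈ r ] f p
∑<-nth {m = m} []      _         = ∑<-zero m
∑<-nth {f = f} (x ∷ r) (s≤s r≤m) = cong (f x +_) (∑<-nth r r≤m)

∑<-column : ∀ {m} (T : List (List A)) → All (λ r → length r ≤ m) T →
            ∑[ j < m ] ∑[ p ∈ column T j ] f p ≡ ∑[ p ∈ concat T ] f p
∑<-column {m = m} [] [] = ∑<-zero m
∑<-column {f = f} {m = m} (r ∷ rs) (r≤m ∷ rs≤m) = begin
  ∑[ j < m ] ∑[ p ∈ column (r ∷ rs) j ] f p
    ≡⟨ ∑<-cong m (∑-column-∷ r rs) ⟩
  ∑[ j < m ] (maybe′ f 0 (nth r j) + ∑[ p ∈ column rs j ] f p)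
    ≡⟨ ∑<-+ m ⟩
  ∑[ j < m ] maybe′ f 0 (nth r j) + ∑[ j < m ] ∑[ p ∈ column rs j ] f p
    ≡⟨ cong₂ _+_ (∑<-nth r r≤m) (∑<-column rs rs≤m) ⟩
  ∑[ p ∈ r ] f p + ∑[ p ∈ concat rs ] f p
    ≡⟨ ∑-++ r (concat rs) ⟨
  ∑[ p ∈ r ++ concat rs ] f p ∎
  where open ≡-Reasoning

-- For a partition ps, min(k, ps′ⱼ) is the number of cells of column j in the first k rows.
count-<-tableau : ∀ (g : A → ℕ) k {m ps} (T : List (List A)) → NonIncreasing ps → All (_≤ m) ps →
                  HasShape T ps → All (Rainbow g) (columns m T) →
                  ∑[ p ∈ concat T ] ⟦ g p < k ⟧ ≤ sum (take k ps)
count-<-tableau g k {m} {ps} T ni ps≤m refl rainbow = begin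
  ∑[ p ∈ concat T ] ⟦ g p < k ⟧               ≡⟨ ∑<-column T (AllP.map⁻ ps≤m) ⟨
  ∑[ j < m ] ∑[ p ∈ column T j ] ⟦ g p < k ⟧  ≤⟨ ∑<-mono m column-bound ⟩
  ∑[ j < m ] conjugate (take k ps) j           ≡⟨ ∑<-conjugate (take k ps) (AllP.take⁺ k ps≤m) ⟩
  sum (take k ps)                              ∎
  where
  open ≤-Reasoning
  column-bound : ∀ j → j < m → ∑[ p ∈ column T j ] ⟦ g p < k ⟧ ≤ conjugate (take k ps) j
  column-bound j j<m = begin
    ∑[ p ∈ column T j ] ⟦ g p < k ⟧
      ≤⟨ ⊓-glb (count-< g k (columns⁻ {T = T} rainbow j<m)) (∑-mono (λ p → ⟦<⟧≤1 (g p) k) (column T j)) ⟩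
    k ⊓ ∑[ p ∈ column T j ] 1  ≡⟨ cong (k ⊓_) (size-column T j) ⟩
    k ⊓ conjugate ps j         ≤⟨ ⊓-conjugate≤conjugate-take k ni j ⟩
    conjugate (take k ps) j    ∎

-- Tableaux whose i-th row has colour c + i

nth-All : ∀ {P : A → Set} {r} → All P r → ∀ j → Maybe.All P (nth r j)
nth-All []         j       = Maybe.nothing
nth-All (Pp ∷ _)   zero    = Maybe.just Pp
nth-All (_ ∷ Pr)   (suc j) = nth-All Pr j

replicate-+ : ∀ m n {x : A} → replicate (m + n) x ≡ replicate m x ++ replicate n x
replicate-+ zero    n = refl
replicate-+ (suc m) n = cong (_ ∷_) (replicate-+ m n)

blockColours : ℕ → List ℕ → List ℕ
blockColours c []      = []
blockColours c (l ∷ Λ) = replicate l c ++ blockColours (suc c) Λ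

module _ (g : A → ℕ) where

  data RowColoured : ℕ → List (List A) → Set where
    []  : ∀ {c} → RowColoured c []
    _∷_ : ∀ {c r rs} → All (λ p → g p ≡ c) r → RowColoured (suc c) rs → RowColoured c (r ∷ rs)

  column-colours-≥ : ∀ {c T} → RowColoured c T → ∀ j → All (λ p → c ≤ g p) (column T j)
  column-colours-≥ [] j = []
  column-colours-≥ {T = r ∷ rs} (r-c ∷ rs-c) j with nth r j | nth-All r-c j
  ... | just p  | Maybe.just gp≡c = ≤-reflexive (sym gp≡c) ∷ All.map <⇒≤ (column-colours-≥ rs-c j)
  ... | nothing | Maybe.nothing   = All.map <⇒≤ (column-colours-≥ rs-c j)

  column-rainbow : ∀ {c T} → RowColoured c T → ∀ j → Rainbow g (column T j)
  column-rainbow [] j = []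
  column-rainbow {T = r ∷ rs} (r-c ∷ rs-c) j with nth r j | nth-All r-c j
  ... | just p  | Maybe.just gp≡c =
    All.map (λ c<gq gp≡gq → <⇒≢ c<gq (trans (sym gp≡c) gp≡gq)) (column-colours-≥ rs-c j)
    ∷ column-rainbow rs-c j
  ... | nothing | Maybe.nothing   = column-rainbow rs-c j

  concat-colours-< : ∀ {c T} → RowColoured c T → All (λ p → g p < c + length T) (concat T)
  concat-colours-< [] = []
  concat-colours-< {c} {r ∷ rs} (r-c ∷ rs-c) =
    AllP.++⁺ (All.map (λ gp≡c → subst (_< c + suc (length rs)) (sym gp≡c) (m<m+n c (s≤s z≤n))) r-c)
             (All.map (λ gp< → ≤-trans gp< (≤-reflexive (sym (+-suc c (length rs))))) (concat-colours-< rs-c))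

  split-replicate : ∀ {c} l xs {ys} → map g xs ≡ replicate l c ++ ys →
                    ∃₂ λ us vs → xs ≡ us ++ vs × length us ≡ l × All (λ p → g p ≡ c) us × map g vs ≡ ys
  split-replicate zero    xs       e = [] , xs , refl , refl , [] , e
  split-replicate (suc l) (x ∷ xs) e with ∷-injective e
  ... | gx≡c , e′ with split-replicate l xs e′
  ... | us , vs , refl , refl , us-c , e″ = x ∷ us , vs , refl , refl , gx≡c ∷ us-c , e″

  fillRows : ∀ c ps xs → map g xs ≡ blockColours c ps →
             Σ (List (List A)) λ T → HasShape T ps × concat T ≡ xs × RowColoured c T
  fillRows c []       []  e = [] , refl , refl , []
  fillRows c (l ∷ ps) xs e with split-replicate l xs e
  ... | u , vs , refl , refl , u-c , e′ with fillRows (suc c) ps vs e′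
  ... | T , refl , refl , T-c = u ∷ T , refl , refl , u-c ∷ T-c

  record Filling (c : ℕ) (ϑ ω : List ℕ) (xs : List A) : Set where
    field
      T S        : List (List A)
      shapeT     : HasShape T ϑ
      shapeS     : HasShape S ω
      perm       : concat T ++ concat S ↭ xs
      T-coloured : RowColoured c T
      S-coloured : RowColoured c S

  consRows : ∀ {c ϑ ω vs u₁ u₂} → All (λ p → g p ≡ c) u₁ → All (λ p → g p ≡ c) u₂ →
             Filling (suc c) ϑ ω vs → Filling c (length u₁ ∷ ϑ) (length u₂ ∷ ω) (u₁ ++ u₂ ++ vs)
  consRows {u₁ = u₁} {u₂} u₁-c u₂-c F = record
    { T = u₁ ∷ T ; S = u₂ ∷ S
    ; shapeT = cong (length u₁ ∷_) shapeT ; shapeS = cong (length u₂ ∷_) shapeS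
    ; perm = begin
        (u₁ ++ concat T) ++ u₂ ++ concat S  ≡⟨ ++-assoc u₁ (concat T) _ ⟩
        u₁ ++ concat T ++ u₂ ++ concat S    ↭⟨ PermP.++⁺ˡ u₁ (PermP.shifts (concat T) u₂) ⟩
        u₁ ++ u₂ ++ concat T ++ concat S    ↭⟨ PermP.++⁺ˡ u₁ (PermP.++⁺ˡ u₂ perm) ⟩
        u₁ ++ u₂ ++ _                       ∎
    ; T-coloured = u₁-c ∷ T-coloured ; S-coloured = u₂-c ∷ S-coloured }
    where open Filling F
          open PermutationReasoning

  fill : ∀ c ϑ ω xs → map g xs ≡ blockColours c (ϑ ⊎ₚ ω) → Filling c ϑ ω xs
  fill c [] ω xs e with fillRows c ω xs e
  ... | S , shapeS , refl , S-c = record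
    { T = [] ; S = S ; shapeT = refl ; shapeS = shapeS ; perm = ↭-refl
    ; T-coloured = [] ; S-coloured = S-c }
  fill c ϑ@(_ ∷ _) [] xs e with fillRows c ϑ xs e
  ... | T , shapeT , refl , T-c = record
    { T = T ; S = [] ; shapeT = shapeT ; shapeS = refl ; perm = ↭-reflexive (++-identityʳ (concat T))
    ; T-coloured = T-c ; S-coloured = [] }
  fill c (t ∷ ϑ) (s ∷ ω) xs e
    with split-replicate t xs (trans e (trans (cong (_++ _) (replicate-+ t s)) (++-assoc (replicate t c) _ _)))
  ... | u₁ , rest , refl , refl , u₁-c , e₁ with split-replicate s rest e₁
  ... | u₂ , vs , refl , refl , u₂-c , e₂ = consRows u₁-c u₂-c (fill (suc c) ϑ ω vs e₂)

blockIndex : (Λ : List ℕ) → List (Fin (length Λ))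
blockIndex []      = []
blockIndex (l ∷ Λ) = replicate l Fin.zero ++ map Fin.suc (blockIndex Λ)

module _ {c ℓ} (K : CommutativeRing c ℓ) where
  open CommutativeRing K using (Carrier)
  open Specht K using (blocks)

  blocks≡map-blockIndex : ∀ Λ (a : Fin (length Λ) → Carrier) → blocks Λ a ≡ map a (blockIndex Λ)
  blocks≡map-blockIndex []      a = refl
  blocks≡map-blockIndex (l ∷ Λ) a = sym (begin
    map a (replicate l Fin.zero ++ map Fin.suc (blockIndex Λ))
      ≡⟨ map-++ a (replicate l Fin.zero) _ ⟩
    map a (replicate l Fin.zero) ++ map a (map Fin.suc (blockIndex Λ))
      ≡⟨ cong₂ _++_ (map-replicate a l Fin.zero) (sym (map-∘ (blockIndex Λ))) ⟩
    replicate l (a Fin.zero) ++ map (a ∘ Fin.suc) (blockIndex Λ)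
      ≡⟨ cong (_ ++_) (sym (blocks≡map-blockIndex Λ (a ∘ Fin.suc))) ⟩
    blocks (l ∷ Λ) a ∎)
    where open ≡-Reasoning

map-suc-blockColours : ∀ c Λ → map suc (blockColours c Λ) ≡ blockColours (suc c) Λ
map-suc-blockColours c []      = refl
map-suc-blockColours c (l ∷ Λ) =
  trans (map-++ suc (replicate l c) _) (cong₂ _++_ (map-replicate suc l c) (map-suc-blockColours (suc c) Λ))

map-toℕ-blockIndex : ∀ Λ → map toℕ (blockIndex Λ) ≡ blockColours 0 Λ
map-toℕ-blockIndex []      = refl
map-toℕ-blockIndex (l ∷ Λ) = begin
  map toℕ (replicate l Fin.zero ++ map Fin.suc (blockIndex Λ))
    ≡⟨ map-++ toℕ (replicate l Fin.zero) _ ⟩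
  map toℕ (replicate l Fin.zero) ++ map toℕ (map Fin.suc (blockIndex Λ))
    ≡⟨ cong₂ _++_ (map-replicate toℕ l Fin.zero) (sym (map-∘ (blockIndex Λ))) ⟩
  replicate l 0 ++ map (suc ∘ toℕ) (blockIndex Λ)
    ≡⟨ cong (_ ++_) (trans (map-∘ (blockIndex Λ)) (cong (map suc) (map-toℕ-blockIndex Λ))) ⟩
  replicate l 0 ++ map suc (blockColours 0 Λ)
    ≡⟨ cong (_ ++_) (map-suc-blockColours 0 Λ) ⟩
  blockColours 0 (l ∷ Λ) ∎
  where open ≡-Reasoning

∑-replicate-one : ∀ l {x : A} → f x ≡ 1 → ∑[ y ∈ replicate l x ] f y ≡ l
∑-replicate-one zero    fx≡1 = refl
∑-replicate-one (suc l) fx≡1 = cong₂ _+_ fx≡1 (∑-replicate-one l fx≡1)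

count-blockIndex : ∀ Λ k → ∑[ i ∈ blockIndex Λ ] ⟦ toℕ i < k ⟧ ≡ sum (take k Λ)
count-blockIndex Λ       zero    = ∑-zero (blockIndex Λ)
count-blockIndex []      (suc k) = refl
count-blockIndex (l ∷ Λ) (suc k) = begin
  ∑[ i ∈ replicate l Fin.zero ++ map Fin.suc (blockIndex Λ) ] ⟦ toℕ i < suc k ⟧
    ≡⟨ ∑-++ (replicate l Fin.zero) _ ⟩
  ∑[ i ∈ replicate l Fin.zero ] ⟦ toℕ i < suc k ⟧ + ∑[ i ∈ map Fin.suc (blockIndex Λ) ] ⟦ toℕ i < suc k ⟧
    ≡⟨ cong₂ _+_ (∑-replicate-one l refl) (trans (∑-map Fin.suc (blockIndex Λ)) (count-blockIndex Λ k)) ⟩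
  l + sum (take k Λ) ∎
  where open ≡-Reasoning

tabulate≡map⇒factorises : ∀ {ℓ} {X : Set ℓ} {m n} (a : Fin m → X) (z : Fin n → X) is →
  tabulate z ≡ map a is → Σ (Fin n → Fin m) λ b → (∀ p → z p ≡ a (b p)) × tabulate b ≡ is
tabulate≡map⇒factorises {n = zero}  a z []       e = (λ ()) , (λ ()) , refl
tabulate≡map⇒factorises {n = suc n} a z (i ∷ is) e with ∷-injective e
... | z0≡ai , e′ with tabulate≡map⇒factorises a (z ∘ Fin.suc) is e′
... | b , z≡ab , tab≡is =
  (λ { Fin.zero → i ; (Fin.suc p) → b p }) , (λ { Fin.zero → z0≡ai ; (Fin.suc p) → z≡ab p }) , cong (i ∷_) tab≡is

module Products {c ℓ} (K : CommutativeRing c ℓ) where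
  open CommutativeRing K renaming (sym to ≈-sym; trans to ≈-trans)
  open Specht K

  x≈0⇒xy≈0 : ∀ {x} y → x ≈ 0# → x * y ≈ 0#
  x≈0⇒xy≈0 y x≈0 = ≈-trans (*-congʳ x≈0) (zeroˡ y)

  y≈0⇒xy≈0 : ∀ x {y} → y ≈ 0# → x * y ≈ 0#
  y≈0⇒xy≈0 x y≈0 = ≈-trans (*-congˡ y≈0) (zeroʳ x)

  *-dichotomy : ∀ {p q} {P : Set p} {Q : Set q} {x y} →
                P ⊎ x ≈ 0# → Q ⊎ y ≈ 0# → (P × Q) ⊎ x * y ≈ 0#
  *-dichotomy (inj₂ x≈0) _          = inj₂ (x≈0⇒xy≈0 _ x≈0)
  *-dichotomy (inj₁ _)   (inj₂ y≈0) = inj₂ (y≈0⇒xy≈0 _ y≈0)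
  *-dichotomy (inj₁ p)   (inj₁ q)   = inj₁ (p , q)

  prod-dichotomy : ∀ {p} {P : A → Set p} (f : A → Carrier) → (∀ x → P x ⊎ f x ≈ 0#) →
                   ∀ xs → All P xs ⊎ prod (map f xs) ≈ 0#
  prod-dichotomy f dich []       = inj₁ []
  prod-dichotomy f dich (x ∷ xs) = Sum.map₁ (uncurry _∷_) (*-dichotomy (dich x) (prod-dichotomy f dich xs))

  Δ-dichotomy : ∀ {n} (y : Fin n → Carrier) (g : Fin n → ℕ) → (∀ p q → g p ≡ g q → y p - y q ≈ 0#) →
                ∀ is → Rainbow g is ⊎ Δ y is ≈ 0#
  Δ-dichotomy y g same []       = inj₁ []
  Δ-dichotomy y g same (i ∷ is) =
    Sum.map₁ (uncurry _∷_) (*-dichotomy (prod-dichotomy (λ k → y i - y k) decide is) (Δ-dichotomy y g same is))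
    where
    decide : ∀ k → g i ≢ g k ⊎ y i - y k ≈ 0#
    decide k with g i ≟ g k
    ... | yes gi≡gk = inj₂ (same i k gi≡gk)
    ... | no  gi≢gk = inj₁ gi≢gk

  module _ (isField : IsField K) where

    x≉0∧y≉0⇒xy≉0 : ∀ {x y} → x ≉ 0# → y ≉ 0# → x * y ≉ 0#
    x≉0∧y≉0⇒xy≉0 {x} {y} x≉0 y≉0 xy≈0 with IsField.inverse isField x x≉0
    ... | x⁻¹ , xx⁻¹≈1 = y≉0 (begin
      y               ≈⟨ *-identityˡ y ⟨
      1# * y          ≈⟨ *-congʳ (≈-trans (≈-sym xx⁻¹≈1) (*-comm x x⁻¹)) ⟩
      (x⁻¹ * x) * y   ≈⟨ *-assoc x⁻¹ x y ⟩
      x⁻¹ * (x * y)   ≈⟨ y≈0⇒xy≈0 x⁻¹ xy≈0 ⟩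
      0#              ∎)
      where open ≈-Reasoning setoid

    prod≉0 : ∀ {xs} → All (_≉ 0#) xs → prod xs ≉ 0#
    prod≉0 []           1≈0 = IsField.0≉1 isField (≈-sym 1≈0)
    prod≉0 (x≉0 ∷ xs≉0)     = x≉0∧y≉0⇒xy≉0 x≉0 (prod≉0 xs≉0)

    Δ≉0 : ∀ {n} (y : Fin n → Carrier) (g : Fin n → ℕ) → (∀ p q → g p ≢ g q → y p - y q ≉ 0#) →
          ∀ {is} → Rainbow g is → Δ y is ≉ 0#
    Δ≉0 y g distinct [] = prod≉0 []
    Δ≉0 y g distinct {i ∷ _} (gi≢ ∷ rainbow) =
      x≉0∧y≉0⇒xy≉0 (prod≉0 (AllP.map⁺ (All.map (distinct i _) gi≢))) (Δ≉0 y g distinct rainbow)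

module BlockPoint {c ℓ} (K : CommutativeRing c ℓ) {n} (ϑ ω : List ℕ)
  (a : Fin (length (ϑ ⊎ₚ ω)) → CommutativeRing.Carrier K) (z : Fin n → CommutativeRing.Carrier K)
  (z≡blocks : toList z ≡ Specht.blocks K (ϑ ⊎ₚ ω) a) where

  open CommutativeRing K using (_≈_; _≉_; _*_; _-_; 0#; -‿inverseʳ; ring)
  open Specht K
  open Products K
  open RingProperties ring using (x∙y⁻¹≈ε⇒x≈y)

  Λ : List ℕ
  Λ = ϑ ⊎ₚ ω

  private
    factorisation : Σ (Fin n → Fin (length Λ)) λ b → (∀ p → z p ≡ a (b p)) × tabulate b ≡ blockIndex Λ
    factorisation = tabulate≡map⇒factorises a z (blockIndex Λ) (trans z≡blocks (blocks≡map-blockIndex K Λ a))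

  block : Fin n → Fin (length Λ)
  block = proj₁ factorisation

  z≡a∘block : ∀ p → z p ≡ a (block p)
  z≡a∘block = proj₁ (proj₂ factorisation)

  map-block : map block (allFin n) ≡ blockIndex Λ
  map-block = trans (map-tabulate id block) (proj₂ (proj₂ factorisation))

  colour : Fin n → ℕ
  colour = toℕ ∘ block

  colours : map colour (allFin n) ≡ blockColours 0 Λ
  colours = trans (map-∘ (allFin n)) (trans (cong (map toℕ) map-block) (map-toℕ-blockIndex Λ))

  count-colour-< : ∀ k → ∑[ p ∈ allFin n ] ⟦ colour p < k ⟧ ≡ sum (take k Λ)
  count-colour-< k = begin
    ∑[ p ∈ allFin n ] ⟦ colour p < k ⟧             ≡⟨ ∑-map block (allFin n) ⟨
    ∑[ i ∈ map block (allFin n) ] ⟦ toℕ i < k ⟧    ≡⟨ cong (λ is → ∑[ i ∈ is ] ⟦ toℕ i < k ⟧) map-block ⟩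
    ∑[ i ∈ blockIndex Λ ] ⟦ toℕ i < k ⟧            ≡⟨ count-blockIndex Λ k ⟩
    sum (take k Λ)                                 ∎
    where open ≡-Reasoning

  same-colour⇒sq-z≈ : ∀ p q → colour p ≡ colour q → sq z p - sq z q ≈ 0#
  same-colour⇒sq-z≈ p q colour-p≡q = subst (λ v → sq z p - v * v ≈ 0#) zp≡zq (-‿inverseʳ (sq z p))
    where zp≡zq : z p ≡ z q
          zp≡zq = trans (z≡a∘block p) (trans (cong a (toℕ-injective colour-p≡q)) (sym (z≡a∘block q)))

  RainbowColumns : ∀ {λ′ μ} → Bitableau n λ′ μ → Set
  RainbowColumns B = All (Rainbow colour) (columns n T) × All (Rainbow colour) (columns n S)
    where open Bitableau B

  rainbow-or-sp≈0 : ∀ {λ′ μ} (B : Bitableau n λ′ μ) → RainbowColumns B ⊎ sp B z ≈ 0#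
  rainbow-or-sp≈0 B = Sum.map₂ (x≈0⇒xy≈0 _) (*-dichotomy (columns-dichotomy T) (columns-dichotomy S))
    where
    open Bitableau B
    columns-dichotomy : ∀ U → All (Rainbow colour) (columns n U) ⊎ prod (map (Δ (sq z)) (columns n U)) ≈ 0#
    columns-dichotomy U = prod-dichotomy (Δ (sq z)) (Δ-dichotomy (sq z) colour same-colour⇒sq-z≈) (columns n U)

  rainbow⇒partial-sum≤ : ∀ {λ′ μ} k → IsBP n λ′ μ → (B : Bitableau n λ′ μ) → RainbowColumns B →
                         sum (take k Λ) ≤ sum (take k (λ′ ⊎ₚ μ))
  rainbow⇒partial-sum≤ {λ′} {μ} k bp@(λ′-partition , μ-partition , _) B (T-rainbow , S-rainbow) = begin
    sum (take k Λ)
      ≡⟨ count-colour-< k ⟨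
    ∑[ p ∈ allFin n ] ⟦ colour p < k ⟧
      ≡⟨ sum-↭ (PermP.map⁺ (λ p → ⟦ colour p < k ⟧) (↭-sym bij)) ⟩
    ∑[ p ∈ concat T ++ concat S ] ⟦ colour p < k ⟧
      ≡⟨ ∑-++ (concat T) (concat S) ⟩
    ∑[ p ∈ concat T ] ⟦ colour p < k ⟧ + ∑[ p ∈ concat S ] ⟦ colour p < k ⟧
      ≤⟨ +-mono-≤ (count-<-tableau colour k T (proj₁ λ′-partition) λ′≤n shapeT T-rainbow)
                  (count-<-tableau colour k S (proj₁ μ-partition) μ≤n shapeS S-rainbow) ⟩
    sum (take k λ′) + sum (take k μ)
      ≡⟨ sum-take-⊎ₚ k λ′ μ ⟨
    sum (take k (λ′ ⊎ₚ μ)) ∎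
    where
    open Bitableau B
    open ≤-Reasoning
    λ′≤n : All (_≤ n) λ′
    λ′≤n = proj₁ (IsBP⇒parts≤ bp)
    μ≤n : All (_≤ n) μ
    μ≤n = proj₂ (IsBP⇒parts≤ bp)

  dominated : ∀ {λ′ μ} → IsBP n λ′ μ → ¬ (z ∈V (λ′ , μ)) → Λ ⊴ (λ′ ⊎ₚ μ)
  dominated {λ′} {μ} bp z∉V k with sum (take k Λ) ≤? sum (take k (λ′ ⊎ₚ μ))
  ... | yes Λ≤ = Λ≤
  ... | no  Λ≰ = ⊥-elim (z∉V λ B →
    Sum.[ (λ rainbow → ⊥-elim (Λ≰ (rainbow⇒partial-sum≤ k bp B rainbow))) , id ] (rainbow-or-sp≈0 B))

  module _ (isField : IsField K)
           (a²-distinct : ∀ i j → i ≢ j → a i * a i ≉ a j * a j)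
           (a≉0 : ∀ i → toℕ i < length ω → a i ≉ 0#) where

    different-colour⇒sq-z≉ : ∀ p q → colour p ≢ colour q → sq z p - sq z q ≉ 0#
    different-colour⇒sq-z≉ p q colour-p≢q sq-zp-zq≈0 =
      a²-distinct (block p) (block q) (colour-p≢q ∘ cong toℕ)
        (subst₂ (λ u v → u * u ≈ v * v) (z≡a∘block p) (z≡a∘block q) (x∙y⁻¹≈ε⇒x≈y _ _ sq-zp-zq≈0))

    canonical : Filling colour 0 ϑ ω (allFin n)
    canonical = fill colour 0 ϑ ω (allFin n) colours

    open Filling canonical

    canonicalBitableau : Bitableau n ϑ ω
    canonicalBitableau = record { T = T ; S = S ; shapeT = shapeT ; shapeS = shapeS ; bij = perm }

    z≉0-on-S : All (λ p → z p ≉ 0#) (concat S)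
    z≉0-on-S = All.map (λ {p} colour< zp≈0 →
        a≉0 (block p) (subst (colour p <_) length-S colour<) (subst (_≈ 0#) (z≡a∘block p) zp≈0))
      (concat-colours-< colour S-coloured)
      where length-S : length S ≡ length ω
            length-S = trans (sym (length-map length S)) (cong length shapeS)

    rainbow-columns≉0 : ∀ {U} → RowColoured colour 0 U → prod (map (Δ (sq z)) (columns n U)) ≉ 0#
    rainbow-columns≉0 {U} U-coloured = prod≉0 isField (AllP.map⁺ {f = Δ (sq z)} (columns⁺ {m = n} {U} λ j →
      Δ≉0 isField (sq z) colour different-colour⇒sq-z≉ (column-rainbow colour U-coloured j)))

    z∉V : ¬ (z ∈V (ϑ , ω))
    z∉V z∈V = x≉0∧y≉0⇒xy≉0 isField
      (x≉0∧y≉0⇒xy≉0 isField (rainbow-columns≉0 T-coloured) (rainbow-columns≉0 S-coloured))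
      (prod≉0 isField (AllP.map⁺ z≉0-on-S))
      (z∈V canonicalBitableau)

-- Characteristic 0 plays no role once the aᵢ² are assumed distinct, and part (i)
-- holds for arbitrary compositions ϑ, ω.
lemma2 : ∀ {c ℓ : Level} (K : CommutativeRing c ℓ) → IsField K → CharZero K →
    let open CommutativeRing K
        open Specht K
    in ∀ (n : ℕ) (ϑ ω : List ℕ) → IsBP n ϑ ω →
       (a : Fin (length (ϑ ⊎ₚ ω)) → Carrier) →
       (∀ i j → ¬ (i ≡ j) → ¬ (a i * a i ≈ a j * a j)) →
       (∀ i → toℕ i < length ω → ¬ (a i ≈ 0#)) →
       (z : Fin n → Carrier) → toList z ≡ blocks (ϑ ⊎ₚ ω) a →
       ¬ (z ∈V (ϑ , ω))
       × (∀ (λ′ μ : List ℕ) → IsBP n λ′ μ → ¬ (z ∈V (λ′ , μ)) →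
            (ϑ ⊎ₚ ω) ⊴ (λ′ ⊎ₚ μ))
lemma2 K isField _ n ϑ ω _ a a²-distinct a≉0 z z≡blocks =
  z∉V isField a²-distinct a≉0 , λ λ′ μ → dominated
  where open BlockPoint K ϑ ω a z z≡blocks
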